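{- Let $n,k,l,r$ be integers with $k,r\geq 2$ and $n\geq l\geq t+1$, where $t=t(k,r)$. Let $p,q\geq 0$ be the integers with $n=p(l-1)+q$ and $0\leq q<l-1$, and let $s=s(k,r)$. If $H$ is a $(k,l)$-edge-maximal $r$-uniform hypergraph on $n$ vertices, then \[ |E(H)|\leq \begin{cases} p\binom{l-1}{r}+pk+\binom{q}{r}, & \text{if } l-1>s \text{ and } q>s,\\ p\binom{l-1}{r}+(p-1+q)k, & \text{if } l-1>s \text{ and } q\leq s,\\ \binom{l-1}{r}+(n-l+1)k, & \text{if } l-1\leq s. \end{cases} \]
   Context: A hypergraph $H=(V,E)$ has a finite vertex set $V$ and a set $E$ of nonempty subsets of $V$ (edges); it is $r$-uniform if every edge has exactly $r$ elements. $K_n^r$ denotes the complete $r$-uniform hypergraph on $n$ vertices (all $r$-subsets are edges; no edges if $n<r$). A subhypergraph $H'=(V',E')$ of $H$ has $V'\subseteq V$, $E'\subseteq E$ (with each edge of $E'$ contained in $V'$). For $X\subseteq V$, $d_H(X)$ is the number of edges of $H$ meeting both $X$ and $V\setminus X$. The edge-connectivity is $\kappa'(H)=\min\{d_H(X):\emptyset\neq X\subsetneq V\}$. For an $r$-subset $e$ of $V$ not in $E$, $H+e=(V,E\cup\{e\})$. An $r$-uniform hypergraph $H$ on $n$ vertices is $(k,l)$-edge-maximal if every subhypergraph $H'$ of $H$ with $|V(H')|\geq l$ satisfies $\kappa'(H')\leq k$, but for every $r$-subset $e$ of $V(H)$ with $e\notin E(H)$, $H+e$ contains a subhypergraph $H''$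 with $|V(H'')|\geq l$ and $\kappa'(H'')\geq k+1$. Binomial coefficients satisfy $\binom{n}{k}=0$ when $k>n$. For integers $k,r\geq 2$, $t=t(k,r)$ is the integer with $\binom{t-1}{r-1}\leq k<\binom{t}{r-1}$ (the largest integer with $\binom{t-1}{r-1}\le k$), and $s=s(k,r)$ is the largest integer $s$ with $k+\binom{s}{r}\leq ks$. -}

module Defs where

open import Data.Nat using (ℕ; zero; suc; _+_; _*_; _∸_; _≤_; _<_)
open import Data.Bool using (Bool; true; false; _∨_; _∧_; not; if_then_else_)
open import Data.Vec using (Vec; []; _∷_)
open import Data.List using (List; []; _∷_; map; _++_)
open import Data.Product using (Σ; _×_; ∃-syntax)
open import Data.Fin.Subset using (Subset; _⊆_; _⊂_; _∩_; _─_; ∣_∣; Nonempty)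
open import Data.Vec.Properties using (≡-dec)
import Data.Bool as B
open import Relation.Nullary using (¬_; does)
open import Relation.Binary.PropositionalEquality using (_≡_)
open import Data.Nat.Combinatorics using (_C_)

allSubsets : (n : ℕ) → List (Subset n)
allSubsets zero = [] ∷ []
allSubsets (suc n) = map (true ∷_) (allSubsets n) ++ map (false ∷_) (allSubsets n)

count : {A : Set} → (A → Bool) → List A → ℕ
count P [] = 0
count P (x ∷ xs) = (if P x then 1 else 0) + count P xs

nonemptyᵇ : {n : ℕ} → Subset n → Bool
nonemptyᵇ [] = false
nonemptyᵇ (b ∷ bs) = b ∨ nonemptyᵇ bs

record Hypergraph (n : ℕ) : Set where
  field
    edges : Subset n → Bool
open Hypergraph public

_∈E_ : {n : ℕ} → Subset n → Hypergraph n → Set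
e ∈E H = edges H e ≡ true

numEdges : {n : ℕ} → Hypergraph n → ℕ
numEdges {n} H = count (edges H) (allSubsets n)

IsHypergraph : {n : ℕ} → Hypergraph n → Set
IsHypergraph H = ∀ e → e ∈E H → Nonempty e

Uniform : {n : ℕ} → ℕ → Hypergraph n → Set
Uniform r H = ∀ e → e ∈E H → ∣ e ∣ ≡ r

addEdge : {n : ℕ} → Hypergraph n → Subset n → Hypergraph n
addEdge H e = record { edges = λ f → edges H f ∨ does (≡-dec B._≟_ f e) }

-- A subhypergraph H' = (V', E') of H (V' ⊆ V(H) = Fin n automatically)
record Sub {n : ℕ} (H : Hypergraph n) : Set where
  field
    vset  : Subset n
    eset  : Subset n → Bool
    eset⊆E : ∀ e → eset e ≡ true → e ∈E H
    eset⊆V : ∀ e → eset e ≡ true → e ⊆ vset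
open Sub public

dSub : {n : ℕ} {H : Hypergraph n} → Sub H → Subset n → ℕ
dSub {n} S X =
  count (λ e → eset S e ∧ (nonemptyᵇ (e ∩ X) ∧ nonemptyᵇ (e ∩ (vset S ─ X))))
        (allSubsets n)

-- κ'(H') ≤ k  (the minimum over ∅ ≠ X ⊊ V(H') of d_{H'}(X) is at most k)
ConnLe : {n : ℕ} {H : Hypergraph n} → Sub H → ℕ → Set
ConnLe S k = ∃[ X ] (Nonempty X × X ⊂ vset S × dSub S X ≤ k)

-- κ'(H') ≥ m  (every ∅ ≠ X ⊊ V(H') has d_{H'}(X) ≥ m)
ConnGe : {n : ℕ} {H : Hypergraph n} → Sub H → ℕ → Set
ConnGe S m = ∀ X → Nonempty X → X ⊂ vset S → m ≤ dSub S X

EdgeMaximal : {n : ℕ} → ℕ → ℕ → ℕ → Hypergraph n → Set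
EdgeMaximal {n} r k l H =
  (∀ (S : Sub H) → l ≤ ∣ vset S ∣ → ConnLe S k)
  × (∀ (e : Subset n) → ∣ e ∣ ≡ r → ¬ (e ∈E H) →
       Σ (Sub (addEdge H e)) λ S → l ≤ ∣ vset S ∣ × ConnGe S (suc k))

IsT : ℕ → ℕ → ℕ → Set
IsT k r t = ((t ∸ 1) C (r ∸ 1) ≤ k) × (k < t C (r ∸ 1))

IsS : ℕ → ℕ → ℕ → Set
IsS k r s = (k + s C r ≤ k * s) × (∀ s' → k + s' C r ≤ k * s' → s' ≤ s)

module Submission where

-- Every vertex set U with |U| ≥ l has a cut X, U ∖ X crossed by at most
-- k edges of H[U], so by induction on |U|, |E(H[U])| + k ≤ F |U| for every F with
-- C(m,r) + k ≤ F m for m < l and F a + F b ≤ F (a + b) whenever a + b ≥ l.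
-- The three bounds are F n − k for two such F, built from the value C(m,r) + k of a
-- clique and the value m k of a chain of vertices of degree k: s is the point where the
-- former overtakes the latter, and beyond t the binomial grows by more than k per vertex,
-- which together with convexity of m ↦ C(m,r) gives superadditivity. With L = l − 1,
-- chainBound (L ≤ s) is K_L followed by vertices of degree k, and blockBound (s < L) is
-- ⌊m/L⌋ copies of K_L, each paying k for its cut, plus part (m mod L), the larger of the
-- two values on the remainder (and 0 on an empty one).

open import Defs
open import Data.Nat using (ℕ; _+_; _*_; _∸_; _≤_; _<_)
open import Data.Nat.Combinatorics using (_C_)
open import Data.Product using (_×_)
open import Relation.Binary.PropositionalEquality using (_≡_)

open import Data.Nat
open import Data.Nat.Properties
open import Data.Nat.DivMod
open import Data.Nat.Combinatorics using (nCk+nC[k+1]≡[n+1]C[k+1])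
open import Data.Nat.Tactic.RingSolver using (solve-∀)
open import Data.Bool using (Bool; true; false; _∨_; _∧_; not; if_then_else_)
open import Data.Bool.Properties using (T-≡; ∧-identityʳ; ∧-zeroʳ)
open import Data.Vec using ([]; _∷_)
open import Data.Vec.Base using (here; there)
open import Data.List using (List; []; _∷_; map; _++_)
open import Data.Product using (_,_; proj₁; proj₂)
open import Data.Sum using (_⊎_; inj₁; inj₂)
open import Data.Fin.Subset using (Subset; _⊆_; _∩_; _─_; ∣_∣; Nonempty; ⊤; ⁅_⁆; _∈_)
open import Data.Fin.Subset.Properties using (p⊆q⇒∣p∣≤∣q∣; p⊂q⇒∣p∣<∣q∣; ∣⁅x⁆∣≡1; x∈⁅y⁆⇒x≡y; drop-∷-⊆; ∣⊤∣≡n)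
open import Function.Bundles using (Equivalence)
open import Relation.Binary.PropositionalEquality
open import Relation.Nullary using (yes; no)
open import Relation.Nullary.Negation using (contradiction)

pascal : ∀ x j → suc x C suc j ≡ x C suc j + x C j
pascal x j = trans (sym (nCk+nC[k+1]≡[n+1]C[k+1] x j)) (+-comm (x C j) (x C suc j))

C-≤-suc : ∀ j x → x C j ≤ suc x C j
C-≤-suc zero    x = ≤-refl
C-≤-suc (suc j) x = subst (x C suc j ≤_) (sym (pascal x j)) (m≤m+n _ _)

C-mono : ∀ j {x y} → x ≤ y → x C j ≤ y C j
C-mono j {y = zero}  z≤n = ≤-refl
C-mono j {x} {suc y} x≤1+y with m≤n⇒m<n∨m≡n x≤1+y
... | inj₁ x<1+y = ≤-trans (C-mono j (≤-pred x<1+y)) (C-≤-suc j y)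
... | inj₂ refl  = ≤-refl

C-convex : ∀ j d {x y} → x ≤ y → (x + d) C j + y C j ≤ x C j + (y + d) C j
C-convex zero    d       x≤y = ≤-refl
C-convex (suc j) zero {x} {y} x≤y
  rewrite +-identityʳ x | +-identityʳ y = ≤-refl
C-convex (suc j) (suc d) {x} {y} x≤y = begin
  (x + suc d) C suc j + y C suc j                   ≡⟨ cong (λ z → z C suc j + y C suc j) (+-suc x d) ⟩
  suc (x + d) C suc j + y C suc j                   ≡⟨ cong (_+ y C suc j) (pascal (x + d) j) ⟩
  (x + d) C suc j + (x + d) C j + y C suc j         ≡⟨ rearrange ((x + d) C suc j) ((x + d) C j) (y C suc j) ⟩
  ((x + d) C suc j + y C suc j) + (x + d) C j       ≤⟨ +-mono-≤ (C-convex (suc j) d x≤y) (C-mono j (+-monoˡ-≤ d x≤y)) ⟩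
  (x C suc j + (y + d) C suc j) + (y + d) C j       ≡⟨ +-assoc (x C suc j) _ _ ⟩
  x C suc j + ((y + d) C suc j + (y + d) C j)       ≡⟨ cong (x C suc j +_) (sym (pascal (y + d) j)) ⟩
  x C suc j + suc (y + d) C suc j                   ≡⟨ cong (λ z → x C suc j + z C suc j) (sym (+-suc y d)) ⟩
  x C suc j + (y + suc d) C suc j                   ∎
  where
  open ≤-Reasoning
  rearrange : ∀ a b c → a + b + c ≡ (a + c) + b
  rearrange = solve-∀

C-convex-sum : ∀ j {a b x y} → a + b ≡ x + y → x ≤ a → a ≤ y → a C j + b C j ≤ x C j + y C j
C-convex-sum j {a} {b} {x} {y} a+b≡x+y x≤a a≤y with m≤n⇒∃[o]m+o≡n x≤a | m≤n⇒∃[o]m+o≡n a≤y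
... | d , refl | e , refl =
  subst₂ (λ u v → (x + d) C j + u C j ≤ x C j + v C j) (sym b≡x+e) (swap x e d) (C-convex j d (m≤m+n x e))
  where
  reassoc : ∀ x d e → x + (x + d + e) ≡ x + d + (x + e)
  reassoc = solve-∀
  swap : ∀ x e d → x + e + d ≡ x + d + e
  swap = solve-∀
  b≡x+e : b ≡ x + e
  b≡x+e = +-cancelˡ-≡ (x + d) b (x + e) (trans a+b≡x+y (reassoc x d e))

1C[1+j]≡0 : ∀ {j} → 1 ≤ j → 1 C suc j ≡ 0
1C[1+j]≡0 {suc j} _ = refl

nCj>0⇒n>0 : ∀ {n j} → 1 ≤ j → 0 < n C j → 0 < n
nCj>0⇒n>0 {suc n} _ _ = s≤s z≤n
nCj>0⇒n>0 {zero} {suc j} _ ()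

∧-elimˡ : ∀ {a b} → a ∧ b ≡ true → a ≡ true
∧-elimˡ {true} _ = refl

∧-elimʳ : ∀ {a b} → a ∧ b ≡ true → b ≡ true
∧-elimʳ {true} b≡true = b≡true

∧-intro : ∀ {a b} → a ≡ true → b ≡ true → a ∧ b ≡ true
∧-intro refl refl = refl

indicator : Bool → ℕ
indicator b = if b then 1 else 0

module _ {A : Set} where

  count-++ : ∀ (P : A → Bool) xs ys → count P (xs ++ ys) ≡ count P xs + count P ys
  count-++ P []       ys = refl
  count-++ P (x ∷ xs) ys = trans (cong (indicator (P x) +_) (count-++ P xs ys)) (sym (+-assoc (indicator (P x)) _ _))

  count-map : ∀ {B : Set} (P : B → Bool) (f : A → B) xs → count P (map f xs) ≡ count (λ x → P (f x)) xs
  count-map P f []       = refl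
  count-map P f (x ∷ xs) = cong (indicator (P (f x)) +_) (count-map P f xs)

  count-cong : ∀ {P Q : A → Bool} → (∀ x → P x ≡ Q x) → ∀ xs → count P xs ≡ count Q xs
  count-cong P≗Q []       = refl
  count-cong P≗Q (x ∷ xs) = cong₂ _+_ (cong indicator (P≗Q x)) (count-cong P≗Q xs)

  count-false : ∀ {P : A → Bool} → (∀ x → P x ≡ false) → ∀ xs → count P xs ≡ 0
  count-false P≡false []       = refl
  count-false P≡false (x ∷ xs) rewrite P≡false x = count-false P≡false xs

  count-mono : ∀ {P Q : A → Bool} → (∀ x → P x ≡ true → Q x ≡ true) → ∀ xs → count P xs ≤ count Q xs
  count-mono P⇒Q []       = z≤n
  count-mono {P} P⇒Q (x ∷ xs) with P x in Px
  ... | true  rewrite P⇒Q x Px = s≤s (count-mono P⇒Q xs)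
  ... | false = ≤-trans (count-mono P⇒Q xs) (m≤n+m _ _)

  count-∪₃ : ∀ {P Q R S : A → Bool} → (∀ x → P x ≡ true → Q x ≡ true ⊎ R x ≡ true ⊎ S x ≡ true) →
             ∀ xs → count P xs ≤ count Q xs + count R xs + count S xs
  count-∪₃ P⇒ []       = z≤n
  count-∪₃ {P} {Q} {R} {S} P⇒ (x ∷ xs) = begin
    indicator (P x) + count P xs
      ≤⟨ +-mono-≤ (indicator-∪₃ (P x) (Q x) (R x) (S x) (P⇒ x)) (count-∪₃ P⇒ xs) ⟩
    (indicator (Q x) + indicator (R x) + indicator (S x)) + (count Q xs + count R xs + count S xs)
      ≡⟨ regroup (indicator (Q x)) (indicator (R x)) (indicator (S x)) (count Q xs) (count R xs) (count S xs) ⟩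
    (indicator (Q x) + count Q xs) + (indicator (R x) + count R xs) + (indicator (S x) + count S xs) ∎
    where
    open ≤-Reasoning
    regroup : ∀ a b c d e f → (a + b + c) + (d + e + f) ≡ (a + d) + (b + e) + (c + f)
    regroup = solve-∀
    indicator-∪₃ : ∀ p a b c → (p ≡ true → a ≡ true ⊎ b ≡ true ⊎ c ≡ true) →
                   indicator p ≤ indicator a + indicator b + indicator c
    indicator-∪₃ false _     _     _ _  = z≤n
    indicator-∪₃ true  true  _     _ _  = s≤s z≤n
    indicator-∪₃ true  false true  _ _  = s≤s z≤n
    indicator-∪₃ true  false false _ p⇒ with p⇒ refl
    ... | inj₂ (inj₂ refl) = s≤s z≤n

_⊆ᵇ_ : ∀ {n} → Subset n → Subset n → Bool
[]       ⊆ᵇ []       = true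
(x ∷ xs) ⊆ᵇ (y ∷ ys) = (not x ∨ y) ∧ (xs ⊆ᵇ ys)

⊆ᵇ-sound : ∀ {n} {e U : Subset n} → e ⊆ᵇ U ≡ true → e ⊆ U
⊆ᵇ-sound {e = true  ∷ e} {true  ∷ U} _   here        = here
⊆ᵇ-sound {e = true  ∷ e} {true  ∷ U} e⊆U (there x∈e) = there (⊆ᵇ-sound e⊆U x∈e)
⊆ᵇ-sound {e = false ∷ e} {u     ∷ U} e⊆U (there x∈e) = there (⊆ᵇ-sound e⊆U x∈e)

⊆ᵇ-⊤ : ∀ {n} (e : Subset n) → e ⊆ᵇ ⊤ ≡ true
⊆ᵇ-⊤ []          = refl
⊆ᵇ-⊤ (true  ∷ e) = ⊆ᵇ-⊤ e
⊆ᵇ-⊤ (false ∷ e) = ⊆ᵇ-⊤ e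

⊈⇒meets-─ : ∀ {n} (e U X : Subset n) → e ⊆ᵇ U ≡ true → e ⊆ᵇ X ≡ false → nonemptyᵇ (e ∩ (U ─ X)) ≡ true
⊈⇒meets-─ []          []         []          _   ()
⊈⇒meets-─ (false ∷ e) (u     ∷ U) (x     ∷ X) e⊆U e⊈X = ⊈⇒meets-─ e U X e⊆U e⊈X
⊈⇒meets-─ (true  ∷ e) (true  ∷ U) (true  ∷ X) e⊆U e⊈X = ⊈⇒meets-─ e U X e⊆U e⊈X
⊈⇒meets-─ (true  ∷ e) (true  ∷ U) (false ∷ X) _   _   = refl

⊈─⇒meets : ∀ {n} (e U X : Subset n) → e ⊆ᵇ U ≡ true → e ⊆ᵇ (U ─ X) ≡ false → nonemptyᵇ (e ∩ X) ≡ true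
⊈─⇒meets []          []         []          _   ()
⊈─⇒meets (false ∷ e) (u     ∷ U) (x     ∷ X) e⊆U e⊈U─X = ⊈─⇒meets e U X e⊆U e⊈U─X
⊈─⇒meets (true  ∷ e) (true  ∷ U) (true  ∷ X) _   _     = refl
⊈─⇒meets (true  ∷ e) (true  ∷ U) (false ∷ X) e⊆U e⊈U─X = ⊈─⇒meets e U X e⊆U e⊈U─X

∣p∣+∣q─p∣≡∣q∣ : ∀ {n} {X U : Subset n} → X ⊆ U → ∣ X ∣ + ∣ U ─ X ∣ ≡ ∣ U ∣
∣p∣+∣q─p∣≡∣q∣ {X = []}        {[]}        _   = refl
∣p∣+∣q─p∣≡∣q∣ {X = true  ∷ X} {true  ∷ U} X⊆U = cong suc (∣p∣+∣q─p∣≡∣q∣ (drop-∷-⊆ X⊆U))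
∣p∣+∣q─p∣≡∣q∣ {X = true  ∷ X} {false ∷ U} X⊆U = contradiction (X⊆U here) λ ()
∣p∣+∣q─p∣≡∣q∣ {X = false ∷ X} {true  ∷ U} X⊆U = trans (+-suc ∣ X ∣ _) (cong suc (∣p∣+∣q─p∣≡∣q∣ (drop-∷-⊆ X⊆U)))
∣p∣+∣q─p∣≡∣q∣ {X = false ∷ X} {false ∷ U} X⊆U = ∣p∣+∣q─p∣≡∣q∣ (drop-∷-⊆ X⊆U)

Nonempty⇒∣p∣>0 : ∀ {n} {X : Subset n} → Nonempty X → 0 < ∣ X ∣
Nonempty⇒∣p∣>0 {X = X} (x , x∈X) = subst (_≤ ∣ X ∣) (∣⁅x⁆∣≡1 x) (p⊆q⇒∣p∣≤∣q∣ ⁅x⁆⊆X)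
  where
  ⁅x⁆⊆X : ⁅ x ⁆ ⊆ X
  ⁅x⁆⊆X y∈⁅x⁆ = subst (_∈ X) (sym (x∈⁅y⁆⇒x≡y x y∈⁅x⁆)) x∈X

count-subsets-of-size : ∀ {n} (U : Subset n) r → count (λ e → (e ⊆ᵇ U) ∧ (∣ e ∣ ≡ᵇ r)) (allSubsets n) ≡ ∣ U ∣ C r
count-subsets-of-size []      zero    = refl
count-subsets-of-size []      (suc r) = refl
count-subsets-of-size {suc n} (u ∷ U) r = begin
  count P (map (true ∷_) S ++ map (false ∷_) S)                      ≡⟨ count-++ P (map (true ∷_) S) (map (false ∷_) S) ⟩
  count P (map (true ∷_) S) + count P (map (false ∷_) S)             ≡⟨ cong₂ _+_ (count-map P (true ∷_) S) (count-map P (false ∷_) S) ⟩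
  count (λ e → P (true ∷ e)) S + count (λ e → P (false ∷ e)) S       ≡⟨ by-first-vertex u r ⟩
  ∣ u ∷ U ∣ C r                                                      ∎
  where
  open ≡-Reasoning
  S : List (Subset n)
  S = allSubsets n
  P : Subset (suc n) → Bool
  P e = (e ⊆ᵇ (u ∷ U)) ∧ (∣ e ∣ ≡ᵇ r)
  by-first-vertex : ∀ b r → count (λ e → ((true ∷ e) ⊆ᵇ (b ∷ U)) ∧ (∣ true ∷ e ∣ ≡ᵇ r)) S
                          + count (λ e → ((false ∷ e) ⊆ᵇ (b ∷ U)) ∧ (∣ false ∷ e ∣ ≡ᵇ r)) S ≡ ∣ b ∷ U ∣ C r
  by-first-vertex false r       = trans (cong (_+ count (λ e → (e ⊆ᵇ U) ∧ (∣ e ∣ ≡ᵇ r)) S) (count-false (λ _ → refl) S)) (count-subsets-of-size U r)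
  by-first-vertex true  zero    = cong₂ _+_ (count-false (λ e → ∧-zeroʳ (e ⊆ᵇ U)) S) (count-subsets-of-size U zero)
  by-first-vertex true  (suc r) = trans (cong₂ _+_ (count-subsets-of-size U r) (count-subsets-of-size U (suc r)))
                                        (nCk+nC[k+1]≡[n+1]C[k+1] ∣ U ∣ r)

module _ {n : ℕ} (H : Hypergraph n) where

  edgesIn : Subset n → ℕ
  edgesIn U = count (λ e → edges H e ∧ (e ⊆ᵇ U)) (allSubsets n)

  induced : Subset n → Sub H
  induced U = record
    { vset   = U
    ; eset   = λ e → edges H e ∧ (e ⊆ᵇ U)
    ; eset⊆E = λ _ e∈ → ∧-elimˡ e∈
    ; eset⊆V = λ _ e∈ → ⊆ᵇ-sound (∧-elimʳ e∈)
    }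

  edgesIn-⊤ : edgesIn ⊤ ≡ numEdges H
  edgesIn-⊤ = count-cong (λ e → trans (cong (edges H e ∧_) (⊆ᵇ-⊤ e)) (∧-identityʳ (edges H e))) (allSubsets n)

  edgesIn≤C : ∀ {r} → Uniform r H → ∀ U → edgesIn U ≤ ∣ U ∣ C r
  edgesIn≤C {r} uniform U = subst (edgesIn U ≤_) (count-subsets-of-size U r) (count-mono inside (allSubsets n))
    where
    inside : ∀ e → edges H e ∧ (e ⊆ᵇ U) ≡ true → (e ⊆ᵇ U) ∧ (∣ e ∣ ≡ᵇ r) ≡ true
    inside e e∈ = ∧-intro (∧-elimʳ e∈) (Equivalence.to T-≡ (≡⇒≡ᵇ ∣ e ∣ r (uniform e (∧-elimˡ e∈))))

  edgesIn-split : ∀ U X → edgesIn U ≤ edgesIn X + edgesIn (U ─ X) + dSub (induced U) X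
  edgesIn-split U X = count-∪₃ classify (allSubsets n)
    where
    classify : ∀ e → edges H e ∧ (e ⊆ᵇ U) ≡ true →
               edges H e ∧ (e ⊆ᵇ X) ≡ true ⊎ edges H e ∧ (e ⊆ᵇ (U ─ X)) ≡ true ⊎
               (edges H e ∧ (e ⊆ᵇ U)) ∧ (nonemptyᵇ (e ∩ X) ∧ nonemptyᵇ (e ∩ (U ─ X))) ≡ true
    classify e e∈ with e ⊆ᵇ X in e⊆X | e ⊆ᵇ (U ─ X) in e⊆U─X
    ... | true  | _     = inj₁ (∧-intro (∧-elimˡ e∈) refl)
    ... | false | true  = inj₂ (inj₁ (∧-intro (∧-elimˡ e∈) refl))
    ... | false | false = inj₂ (inj₂ (∧-intro e∈ (∧-intro (⊈─⇒meets e U X (∧-elimʳ e∈) e⊆U─X)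
                                                          (⊈⇒meets-─ e U X (∧-elimʳ e∈) e⊆X))))

numEdges+k≤ : ∀ {n} {H : Hypergraph n} {r k l} (F : ℕ → ℕ) → Uniform r H →
              (∀ (S : Sub H) → l ≤ ∣ vset S ∣ → ConnLe S k) →
              (∀ {m} → 1 ≤ m → m < l → m C r + k ≤ F m) →
              (∀ {a b} → 1 ≤ a → 1 ≤ b → l ≤ a + b → F a + F b ≤ F (a + b)) →
              1 ≤ n → numEdges H + k ≤ F n
numEdges+k≤ {n} {H} {r} {k} {l} F uniform sparse small super 1≤n =
  subst₂ (λ E m → E + k ≤ F m) (edgesIn-⊤ H) (∣⊤∣≡n n)
    (bound n ⊤ (≤-reflexive (∣⊤∣≡n n)) (subst (1 ≤_) (sym (∣⊤∣≡n n)) 1≤n))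
  where
  bound : ∀ fuel U → ∣ U ∣ ≤ fuel → 1 ≤ ∣ U ∣ → edgesIn H U + k ≤ F ∣ U ∣
  bound zero       U ∣U∣≤0    1≤∣U∣ = contradiction (≤-trans 1≤∣U∣ ∣U∣≤0) λ ()
  bound (suc fuel) U ∣U∣≤1+f 1≤∣U∣ with l ≤? ∣ U ∣
  ... | no  l≰∣U∣ = ≤-trans (+-monoˡ-≤ k (edgesIn≤C H uniform U)) (small 1≤∣U∣ (≰⇒> l≰∣U∣))
  ... | yes l≤∣U∣ with sparse (induced H U) l≤∣U∣
  ...   | X , X≢∅ , X⊂U , cut≤k = begin
    edgesIn H U + k                                        ≤⟨ +-monoˡ-≤ k (edgesIn-split H U X) ⟩
    edgesIn H X + edgesIn H Y + dSub (induced H U) X + k   ≤⟨ +-monoˡ-≤ k (+-monoʳ-≤ (edgesIn H X + edgesIn H Y) cut≤k) ⟩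
    edgesIn H X + edgesIn H Y + k + k                      ≡⟨ regroup (edgesIn H X) (edgesIn H Y) k ⟩
    (edgesIn H X + k) + (edgesIn H Y + k)                  ≤⟨ +-mono-≤ (bound fuel X ∣X∣≤f 1≤∣X∣) (bound fuel Y ∣Y∣≤f 1≤∣Y∣) ⟩
    F ∣ X ∣ + F ∣ Y ∣                                      ≤⟨ super 1≤∣X∣ 1≤∣Y∣ (subst (l ≤_) (sym ∣X∣+∣Y∣≡∣U∣) l≤∣U∣) ⟩
    F (∣ X ∣ + ∣ Y ∣)                                      ≡⟨ cong F ∣X∣+∣Y∣≡∣U∣ ⟩
    F ∣ U ∣                                                ∎
    where
    open ≤-Reasoning
    regroup : ∀ a b k → a + b + k + k ≡ (a + k) + (b + k)
    regroup = solve-∀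
    Y : Subset n
    Y = U ─ X
    ∣X∣+∣Y∣≡∣U∣ : ∣ X ∣ + ∣ Y ∣ ≡ ∣ U ∣
    ∣X∣+∣Y∣≡∣U∣ = ∣p∣+∣q─p∣≡∣q∣ (proj₁ X⊂U)
    1≤∣X∣ : 1 ≤ ∣ X ∣
    1≤∣X∣ = Nonempty⇒∣p∣>0 X≢∅
    1≤∣Y∣ : 1 ≤ ∣ Y ∣
    1≤∣Y∣ = +-cancelˡ-< (∣ X ∣) 0 (∣ Y ∣)
              (subst₂ _<_ (sym (+-identityʳ ∣ X ∣)) (sym ∣X∣+∣Y∣≡∣U∣) (p⊂q⇒∣p∣<∣q∣ X⊂U))
    ∣X∣≤f : ∣ X ∣ ≤ fuel
    ∣X∣≤f = ≤-pred (≤-trans (p⊂q⇒∣p∣<∣q∣ X⊂U) ∣U∣≤1+f)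
    ∣Y∣≤f : ∣ Y ∣ ≤ fuel
    ∣Y∣≤f = ≤-pred (≤-trans (subst (∣ Y ∣ <_) ∣X∣+∣Y∣≡∣U∣ (+-monoˡ-≤ ∣ Y ∣ 1≤∣X∣)) ∣U∣≤1+f)

module Thresholds {k r₁ t s : ℕ} (1≤r₁ : 1 ≤ r₁) (isT : IsT k (suc r₁) t) (isS : IsS k (suc r₁) s) where

  private
    r : ℕ
    r = suc r₁

  1≤t : 1 ≤ t
  1≤t = nCj>0⇒n>0 1≤r₁ (≤-<-trans z≤n (proj₂ isT))

  k<C : ∀ {x} → t ≤ x → k < x C r₁
  k<C t≤x = <-≤-trans (proj₂ isT) (C-mono r₁ t≤x)

  steep : ∀ {x} d → t ≤ x → x C r + d * k ≤ (x + d) C r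
  steep {x} zero t≤x rewrite +-identityʳ x = ≤-reflexive (+-identityʳ (x C r))
  steep {x} (suc d) t≤x = begin
    x C r + (k + d * k)            ≡⟨ rearrange (x C r) k (d * k) ⟩
    (x C r + d * k) + k            ≤⟨ +-mono-≤ (steep d t≤x) (<⇒≤ (k<C (≤-trans t≤x (m≤m+n x d)))) ⟩
    (x + d) C r + (x + d) C r₁     ≡⟨ sym (pascal (x + d) r₁) ⟩
    suc (x + d) C r                ≡⟨ cong (_C r) (sym (+-suc x d)) ⟩
    (x + suc d) C r                ∎
    where
    open ≤-Reasoning
    rearrange : ∀ a b c → a + (b + c) ≡ (a + c) + b
    rearrange = solve-∀

  C+C+k≤C : ∀ {x y} → 1 ≤ x → t ≤ y → x C r + y C r + k ≤ (x + y) C r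
  C+C+k≤C {x} {y} 1≤x t≤y = begin
    x C r + y C r + k              ≤⟨ +-monoʳ-≤ (x C r + y C r) (<⇒≤ (k<C t≤y)) ⟩
    x C r + y C r + y C r₁         ≡⟨ +-assoc (x C r) _ _ ⟩
    x C r + (y C r + y C r₁)       ≡⟨ cong (x C r +_) (sym (pascal y r₁)) ⟩
    x C r + suc y C r              ≤⟨ C-convex-sum r (+-suc x y) 1≤x (m≤m+n x y) ⟩
    1 C r + (x + y) C r            ≡⟨ cong (_+ (x + y) C r) (1C[1+j]≡0 1≤r₁) ⟩
    (x + y) C r                    ∎
    where open ≤-Reasoning

  Admissible : ℕ → Set
  Admissible x = k + x C r ≤ k * x

  admissible-≤t : ∀ {x} → 1 ≤ x → x ≤ t → Admissible x
  admissible-≤t {suc zero} _ _ rewrite 1C[1+j]≡0 1≤r₁ | *-identityʳ k | +-identityʳ k = ≤-refl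
  admissible-≤t {suc (suc y)} _ 2+y≤t = begin
    k + suc (suc y) C r                ≡⟨ cong (k +_) (pascal (suc y) r₁) ⟩
    k + (suc y C r + suc y C r₁)       ≡⟨ sym (+-assoc k _ _) ⟩
    (k + suc y C r) + suc y C r₁       ≤⟨ +-mono-≤ (admissible-≤t (s≤s z≤n) (≤-trans (n≤1+n _) 2+y≤t)) C≤k ⟩
    k * suc y + k                      ≡⟨ +-comm (k * suc y) k ⟩
    k + k * suc y                      ≡⟨ sym (*-suc k (suc y)) ⟩
    k * suc (suc y)                    ∎
    where
    open ≤-Reasoning
    C≤k : suc y C r₁ ≤ k
    C≤k = ≤-trans (C-mono r₁ (<⇒≤pred 2+y≤t)) (proj₁ isT)

  admissible-pred : ∀ {x} → t ≤ x → Admissible (suc x) → Admissible x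
  admissible-pred {x} t≤x adm = +-cancelˡ-≤ k _ _ (begin
    k + (k + x C r)                    ≤⟨ +-monoˡ-≤ (k + x C r) (<⇒≤ (k<C t≤x)) ⟩
    x C r₁ + (k + x C r)               ≡⟨ rearrange (x C r₁) k (x C r) ⟩
    k + (x C r + x C r₁)               ≡⟨ cong (k +_) (sym (pascal x r₁)) ⟩
    k + suc x C r                      ≤⟨ adm ⟩
    k * suc x                          ≡⟨ *-suc k x ⟩
    k + k * x                          ∎)
    where
    open ≤-Reasoning
    rearrange : ∀ a b c → a + (b + c) ≡ b + (c + a)
    rearrange = solve-∀

  t≤s : t ≤ s
  t≤s = proj₂ isS t (admissible-≤t 1≤t ≤-refl)

  admissible-≤s : ∀ {x} → 1 ≤ x → x ≤ s → Admissible x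
  admissible-≤s {x} 1≤x x≤s with x ≤? t | m≤n⇒∃[o]m+o≡n x≤s
  ... | yes x≤t | _         = admissible-≤t 1≤x x≤t
  ... | no  x≰t | d , x+d≡s = downFrom-s d (<⇒≤ (≰⇒> x≰t)) x+d≡s
    where
    downFrom-s : ∀ d {x} → t ≤ x → x + d ≡ s → Admissible x
    downFrom-s zero    {x} _   x+0≡s = subst Admissible (trans (sym x+0≡s) (+-identityʳ x)) (proj₁ isS)
    downFrom-s (suc d) {x} t≤x x+d≡s =
      admissible-pred t≤x (downFrom-s d (m≤n⇒m≤1+n t≤x) (trans (sym (+-suc x d)) x+d≡s))

  C+k≤* : ∀ {x} → 1 ≤ x → x ≤ s → x C r + k ≤ x * k
  C+k≤* {x} 1≤x x≤s = subst₂ _≤_ (+-comm k (x C r)) (*-comm k x) (admissible-≤s 1≤x x≤s)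

  *<C+k : ∀ {x} → s < x → x * k < x C r + k
  *<C+k {x} s<x = subst₂ _<_ (*-comm k x) (+-comm k (x C r)) (≰⇒> (λ adm → <⇒≱ s<x (proj₂ isS x adm)))

  part : ℕ → ℕ
  part q with s <? q
  ... | yes _ = q C r + k
  ... | no  _ = q * k

  part-large : ∀ {q} → s < q → part q ≡ q C r + k
  part-large {q} s<q with s <? q
  ... | yes _   = refl
  ... | no  s≮q = contradiction s<q s≮q

  part-small : ∀ {q} → q ≤ s → part q ≡ q * k
  part-small {q} q≤s with s <? q
  ... | yes s<q = contradiction q≤s (<⇒≱ s<q)
  ... | no  _   = refl

  C+k≤part : ∀ {q} → 1 ≤ q → q C r + k ≤ part q
  C+k≤part {q} 1≤q with s <? q
  ... | yes _   = ≤-refl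
  ... | no  s≮q = C+k≤* 1≤q (≮⇒≥ s≮q)

  *≤part : ∀ q → q * k ≤ part q
  *≤part q with s <? q
  ... | yes s<q = <⇒≤ (*<C+k s<q)
  ... | no  _   = ≤-refl

  private
    cancel-middle : ∀ {q₁ q₂ x y} → q₁ + q₂ ≡ x + y → x ≤ q₂ → q₁ ≤ y
    cancel-middle {q₁} {q₂} {x} {y} eq x≤q₂ =
      +-cancelʳ-≤ x q₁ y (subst (q₁ + x ≤_) (trans eq (+-comm x y)) (+-monoʳ-≤ q₁ x≤q₂))

  part-convex-one-large : ∀ {q₁ q₂ x y} → q₁ + q₂ ≡ x + y → x ≤ q₂ → s < q₁ → q₂ ≤ s →
                          part q₁ + part q₂ ≤ part x + part y
  part-convex-one-large {q₁} {q₂} {x} {y} eq x≤q₂ s<q₁ q₂≤s with m≤n⇒∃[o]m+o≡n x≤q₂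
  ... | e , refl = begin
    part q₁ + part (x + e)           ≡⟨ cong₂ _+_ (part-large s<q₁) (part-small q₂≤s) ⟩
    q₁ C r + k + (x + e) * k         ≡⟨ rearrange (q₁ C r) k x e ⟩
    (q₁ C r + e * k + k) + x * k     ≤⟨ +-mono-≤ (+-monoˡ-≤ k (steep e (≤-trans t≤s (<⇒≤ s<q₁)))) (*≤part x) ⟩
    ((q₁ + e) C r + k) + part x      ≡⟨ cong (λ z → z C r + k + part x) y≡q₁+e ⟨
    (y C r + k) + part x             ≡⟨ cong (_+ part x) (part-large s<y) ⟨
    part y + part x                  ≡⟨ +-comm (part y) (part x) ⟩
    part x + part y                  ∎
    where
    open ≤-Reasoning
    rearrange : ∀ c k x e → c + k + (x + e) * k ≡ (c + e * k + k) + x * k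
    rearrange = solve-∀
    y≡q₁+e : y ≡ q₁ + e
    y≡q₁+e = +-cancelˡ-≡ x y (q₁ + e) (trans (sym eq) (swap q₁ x e))
      where
      swap : ∀ a b c → a + (b + c) ≡ b + (a + c)
      swap = solve-∀
    s<y : s < y
    s<y = <-≤-trans s<q₁ (subst (q₁ ≤_) (sym y≡q₁+e) (m≤m+n q₁ e))

  part-convex : ∀ {q₁ q₂ x y} → q₁ + q₂ ≡ x + y → x ≤ q₁ → x ≤ q₂ → s < y →
                part q₁ + part q₂ ≤ part x + part y
  part-convex {q₁} {q₂} {x} {y} eq x≤q₁ x≤q₂ s<y with q₁ ≤? s | q₂ ≤? s
  ... | yes q₁≤s | yes q₂≤s = begin
    part q₁ + part q₂                ≡⟨ cong₂ _+_ (part-small q₁≤s) (part-small q₂≤s) ⟩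
    q₁ * k + q₂ * k                  ≡⟨ *-distribʳ-+ k q₁ q₂ ⟨
    (q₁ + q₂) * k                    ≡⟨ cong (_* k) eq ⟩
    (x + y) * k                      ≡⟨ *-distribʳ-+ k x y ⟩
    x * k + y * k                    ≤⟨ +-mono-≤ (*≤part x) (*≤part y) ⟩
    part x + part y                  ∎
    where open ≤-Reasoning
  ... | no q₁≰s | yes q₂≤s = part-convex-one-large eq x≤q₂ (≰⇒> q₁≰s) q₂≤s
  ... | yes q₁≤s | no q₂≰s =
    subst (_≤ part x + part y) (+-comm (part q₂) (part q₁))
      (part-convex-one-large (trans (+-comm q₂ q₁) eq) x≤q₁ (≰⇒> q₂≰s) q₁≤s)
  ... | no q₁≰s | no q₂≰s = both-large x≤q₁
    where
    open ≤-Reasoning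
    s<q₁ = ≰⇒> q₁≰s
    s<q₂ = ≰⇒> q₂≰s
    both-large : x ≤ q₁ → part q₁ + part q₂ ≤ part x + part y
    both-large z≤n = begin
      part q₁ + part q₂                ≡⟨ cong₂ _+_ (part-large s<q₁) (part-large s<q₂) ⟩
      q₁ C r + k + (q₂ C r + k)        ≡⟨ rearrange (q₁ C r) (q₂ C r) k ⟩
      q₁ C r + q₂ C r + k + k          ≤⟨ +-monoˡ-≤ k (C+C+k≤C (≤-trans (s≤s z≤n) s<q₁) (≤-trans t≤s (<⇒≤ s<q₂))) ⟩
      (q₁ + q₂) C r + k                ≡⟨ cong (λ z → z C r + k) eq ⟩
      y C r + k                        ≡⟨ part-large s<y ⟨
      part y                           ≡⟨ cong (_+ part y) (part-small z≤n) ⟨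
      part 0 + part y                  ∎
      where
      rearrange : ∀ a b k → a + k + (b + k) ≡ a + b + k + k
      rearrange = solve-∀
    both-large (s≤s _) = begin
      part q₁ + part q₂                ≡⟨ cong₂ _+_ (part-large s<q₁) (part-large s<q₂) ⟩
      q₁ C r + k + (q₂ C r + k)        ≡⟨ rearrange (q₁ C r) (q₂ C r) k ⟩
      (q₁ C r + q₂ C r) + (k + k)      ≤⟨ +-monoˡ-≤ (k + k) (C-convex-sum r eq x≤q₁ (cancel-middle eq x≤q₂)) ⟩
      (x C r + y C r) + (k + k)        ≡⟨ rearrange (x C r) (y C r) k ⟨
      x C r + k + (y C r + k)          ≤⟨ +-mono-≤ (C+k≤part {x} (s≤s z≤n)) (≤-reflexive (sym (part-large s<y))) ⟩
      part x + part y                  ∎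
      where
      rearrange : ∀ a b k → a + k + (b + k) ≡ (a + b) + (k + k)
      rearrange = solve-∀

  part-superadditive : ∀ q₁ q₂ → part q₁ + part q₂ ≤ part (q₁ + q₂)
  part-superadditive q₁ q₂ with (q₁ + q₂) ≤? s
  ... | yes sum≤s = ≤-reflexive (begin
    part q₁ + part q₂                ≡⟨ cong₂ _+_ (part-small (≤-trans (m≤m+n q₁ q₂) sum≤s))
                                                  (part-small (≤-trans (m≤n+m q₂ q₁) sum≤s)) ⟩
    q₁ * k + q₂ * k                  ≡⟨ *-distribʳ-+ k q₁ q₂ ⟨
    (q₁ + q₂) * k                    ≡⟨ part-small sum≤s ⟨
    part (q₁ + q₂)                   ∎)
    where open ≡-Reasoning
  ... | no sum≰s = subst (part q₁ + part q₂ ≤_) (cong (_+ part (q₁ + q₂)) (part-small z≤n))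
                     (part-convex {q₁} {q₂} refl z≤n z≤n (≰⇒> sum≰s))

  module Blocks (L : ℕ) .{{_ : NonZero L}} (s<L : s < L) where

    block : ℕ
    block = L C r + k

    blockBound : ℕ → ℕ
    blockBound m = m / L * block + part (m % L)

    blockBound-eq : ∀ {m} p {q} → m ≡ q + p * L → q < L → blockBound m ≡ p * block + part q
    blockBound-eq {m} p {q} refl q<L = cong₂ (λ a b → a * block + part b) quotient remainder
      where
      remainder : (q + p * L) % L ≡ q
      remainder = trans ([m+kn]%n≡m%n q p L) (m<n⇒m%n≡m q<L)
      quotient : (q + p * L) / L ≡ p
      quotient = begin
        (q + p * L) / L              ≡⟨ +-distrib-/ q (p * L) remainders<L ⟩
        q / L + p * L / L            ≡⟨ cong₂ _+_ (m<n⇒m/n≡0 q<L) (m*n/n≡m p L) ⟩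
        p                            ∎
        where
        open ≡-Reasoning
        remainders<L : q % L + p * L % L < L
        remainders<L = subst (_< L) (sym (trans (cong₂ _+_ (m<n⇒m%n≡m q<L) (m*n%n≡0 p L)) (+-identityʳ q))) q<L

    private
      +-quotRem : ∀ a b → a + b ≡ (a % L + b % L) + (a / L + b / L) * L
      +-quotRem a b = begin
        a + b                                           ≡⟨ cong₂ _+_ (m≡m%n+[m/n]*n a L) (m≡m%n+[m/n]*n b L) ⟩
        (a % L + a / L * L) + (b % L + b / L * L)       ≡⟨ regroup (a % L) (a / L) (b % L) (b / L) L ⟩
        (a % L + b % L) + (a / L + b / L) * L           ∎
        where
        open ≡-Reasoning
        regroup : ∀ x p y q L → (x + p * L) + (y + q * L) ≡ (x + y) + (p + q) * L
        regroup = solve-∀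

      blockBound-+ : ∀ a b → blockBound a + blockBound b ≡ (a / L + b / L) * block + (part (a % L) + part (b % L))
      blockBound-+ a b = regroup (a / L) (b / L) block (part (a % L)) (part (b % L))
        where
        regroup : ∀ p q w x y → (p * w + x) + (q * w + y) ≡ (p + q) * w + (x + y)
        regroup = solve-∀

    blockBound-superadditive : ∀ a b → blockBound a + blockBound b ≤ blockBound (a + b)
    blockBound-superadditive a b with (a % L + b % L) <? L
    ... | yes sum<L = begin
      blockBound a + blockBound b                       ≡⟨ blockBound-+ a b ⟩
      (a / L + b / L) * block + (part (a % L) + part (b % L))
                                                        ≤⟨ +-monoʳ-≤ ((a / L + b / L) * block) (part-superadditive (a % L) (b % L)) ⟩
      (a / L + b / L) * block + part (a % L + b % L)    ≡⟨ blockBound-eq (a / L + b / L) (+-quotRem a b) sum<L ⟨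
      blockBound (a + b)                                ∎
      where open ≤-Reasoning
    ... | no sum≮L = begin
      blockBound a + blockBound b                       ≡⟨ blockBound-+ a b ⟩
      P * block + (part (a % L) + part (b % L))         ≤⟨ +-monoʳ-≤ (P * block) (part-convex {a % L} {b % L} sum≡ q≤a%L q≤b%L s<L) ⟩
      P * block + (part q + part L)                     ≡⟨ cong (λ z → P * block + (part q + z)) (part-large s<L) ⟩
      P * block + (part q + block)                      ≡⟨ carry P block (part q) ⟩
      suc P * block + part q                            ≡⟨ blockBound-eq (suc P) a+b≡ q<L ⟨
      blockBound (a + b)                                ∎
      where
      open ≤-Reasoning
      P : ℕ
      P = a / L + b / L
      q : ℕ
      q = a % L + b % L ∸ L
      sum≡ : a % L + b % L ≡ q + L
      sum≡ = sym (m∸n+n≡m (≮⇒≥ sum≮L))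
      q≤a%L : q ≤ a % L
      q≤a%L = +-cancelʳ-≤ L q (a % L) (subst (_≤ a % L + L) sum≡ (+-monoʳ-≤ (a % L) (<⇒≤ (m%n<n b L))))
      q≤b%L : q ≤ b % L
      q≤b%L = +-cancelʳ-≤ L q (b % L)
                (subst (_≤ b % L + L) (trans (+-comm (b % L) (a % L)) sum≡) (+-monoʳ-≤ (b % L) (<⇒≤ (m%n<n a L))))
      q<L : q < L
      q<L = ≤-<-trans q≤a%L (m%n<n a L)
      carry : ∀ P w h → P * w + (h + w) ≡ suc P * w + h
      carry = solve-∀
      a+b≡ : a + b ≡ q + suc P * L
      a+b≡ = trans (+-quotRem a b) (trans (cong (_+ P * L) sum≡) (shift q L P))
        where
        shift : ∀ q L P → (q + L) + P * L ≡ q + suc P * L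
        shift = solve-∀

    C+k≤blockBound : ∀ {m} → 1 ≤ m → m ≤ L → m C r + k ≤ blockBound m
    C+k≤blockBound {m} 1≤m m≤L with m≤n⇒m<n∨m≡n m≤L
    ... | inj₁ m<L = subst (m C r + k ≤_) (sym (blockBound-eq 0 (sym (+-identityʳ m)) m<L)) (C+k≤part 1≤m)
    ... | inj₂ refl = ≤-reflexive (sym (begin
      blockBound m                ≡⟨ blockBound-eq 1 (sym (+-identityʳ m)) 1≤m ⟩
      1 * block + part 0          ≡⟨ cong₂ _+_ (*-identityˡ block) (part-small z≤n) ⟩
      block + 0                   ≡⟨ +-identityʳ block ⟩
      block                       ∎))
      where open ≡-Reasoning

    blockBound-large-remainder : ∀ {n p q} → n ≡ p * L + q → q < L → s < q →
                                 blockBound n ≡ p * (L C r) + p * k + q C r + k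
    blockBound-large-remainder {n} {p} {q} n≡ q<L s<q = begin
      blockBound n                ≡⟨ blockBound-eq p (trans n≡ (+-comm (p * L) q)) q<L ⟩
      p * block + part q          ≡⟨ cong (p * block +_) (part-large s<q) ⟩
      p * (L C r + k) + (q C r + k) ≡⟨ expand p (L C r) k (q C r) ⟩
      p * (L C r) + p * k + q C r + k ∎
      where
      open ≡-Reasoning
      expand : ∀ p c k d → p * (c + k) + (d + k) ≡ p * c + p * k + d + k
      expand = solve-∀

    blockBound-small-remainder : ∀ {n p q} → n ≡ p * L + q → 1 ≤ p → q < L → q ≤ s →
                                 blockBound n ≡ p * (L C r) + (p ∸ 1 + q) * k + k
    blockBound-small-remainder {n} {suc p} {q} n≡ _ q<L q≤s = begin
      blockBound n                ≡⟨ blockBound-eq (suc p) (trans n≡ (+-comm (suc p * L) q)) q<L ⟩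
      suc p * block + part q      ≡⟨ cong (suc p * block +_) (part-small q≤s) ⟩
      suc p * (L C r + k) + q * k ≡⟨ expand p (L C r) k q ⟩
      suc p * (L C r) + (p + q) * k + k ∎
      where
      open ≡-Reasoning
      expand : ∀ p c k q → suc p * (c + k) + q * k ≡ suc p * c + (p + q) * k + k
      expand = solve-∀

  module Chain (L : ℕ) (1≤L : 1 ≤ L) (L≤s : L ≤ s) where

    chainBound : ℕ → ℕ
    chainBound m = (m ⊓ L) C r + k + (m ∸ L) * k

    chainBound-≤ : ∀ {m} → m ≤ L → chainBound m ≡ m C r + k
    chainBound-≤ {m} m≤L rewrite m≤n⇒m⊓n≡m m≤L | m≤n⇒m∸n≡0 m≤L = +-identityʳ (m C r + k)

    chainBound-L+ : ∀ e → chainBound (L + e) ≡ L C r + k + e * k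
    chainBound-L+ e rewrite m≥n⇒m⊓n≡n (m≤m+n L e) | m+n∸m≡n L e = refl

    chainBound≤* : ∀ {m} → 1 ≤ m → chainBound m ≤ m * k
    chainBound≤* {m} 1≤m with m ≤? L | ≤-total L m
    ... | yes m≤L | _ = ≤-trans (≤-reflexive (chainBound-≤ m≤L)) (C+k≤* 1≤m (≤-trans m≤L L≤s))
    ... | no  m≰L | inj₂ m≤L = contradiction m≤L m≰L
    ... | no  _   | inj₁ L≤m with m≤n⇒∃[o]m+o≡n L≤m
    ...   | e , refl = begin
      chainBound (L + e)            ≡⟨ chainBound-L+ e ⟩
      L C r + k + e * k             ≤⟨ +-monoˡ-≤ (e * k) (C+k≤* 1≤L L≤s) ⟩
      L * k + e * k                 ≡⟨ *-distribʳ-+ k L e ⟨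
      (L + e) * k                   ∎
      where open ≤-Reasoning

    private
      chainBound-superadditive-long : ∀ {a b} → L ≤ a → 1 ≤ b → chainBound a + chainBound b ≤ chainBound (a + b)
      chainBound-superadditive-long {a} {b} L≤a 1≤b with m≤n⇒∃[o]m+o≡n L≤a
      ... | e , refl = begin
        chainBound (L + e) + chainBound b   ≤⟨ +-mono-≤ (≤-reflexive (chainBound-L+ e)) (chainBound≤* 1≤b) ⟩
        L C r + k + e * k + b * k           ≡⟨ +-assoc (L C r + k) (e * k) (b * k) ⟩
        L C r + k + (e * k + b * k)         ≡⟨ cong (L C r + k +_) (*-distribʳ-+ k e b) ⟨
        L C r + k + (e + b) * k             ≡⟨ chainBound-L+ (e + b) ⟨
        chainBound (L + (e + b))            ≡⟨ cong chainBound (+-assoc L e b) ⟨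
        chainBound (L + e + b)              ∎
        where open ≤-Reasoning

      chainBound-superadditive-short : ∀ {a b} → a < L → b < L → L < a + b →
                                       chainBound a + chainBound b ≤ chainBound (a + b)
      chainBound-superadditive-short {a} {b} a<L b<L L<a+b with m≤n⇒∃[o]m+o≡n (<⇒≤ L<a+b)
      ... | e , L+e≡a+b = begin
        chainBound a + chainBound b         ≡⟨ cong₂ _+_ (chainBound-≤ (<⇒≤ a<L)) (chainBound-≤ (<⇒≤ b<L)) ⟩
        a C r + k + (b C r + k)             ≡⟨ regroup (a C r) (b C r) k ⟩
        (a C r + b C r) + (k + k)           ≤⟨ +-monoˡ-≤ (k + k) (C-convex-sum r (trans (sym L+e≡a+b) (+-comm L e)) e≤a (<⇒≤ a<L)) ⟩
        (e C r + L C r) + (k + k)           ≡⟨ regroup (e C r) (L C r) k ⟨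
        e C r + k + (L C r + k)             ≤⟨ +-monoˡ-≤ (L C r + k) (C+k≤* 1≤e (≤-trans e≤a (≤-trans (<⇒≤ a<L) L≤s))) ⟩
        e * k + (L C r + k)                 ≡⟨ +-comm (e * k) (L C r + k) ⟩
        L C r + k + e * k                   ≡⟨ chainBound-L+ e ⟨
        chainBound (L + e)                  ≡⟨ cong chainBound L+e≡a+b ⟩
        chainBound (a + b)                  ∎
        where
        open ≤-Reasoning
        regroup : ∀ a b k → a + k + (b + k) ≡ (a + b) + (k + k)
        regroup = solve-∀
        e≤a : e ≤ a
        e≤a = +-cancelʳ-≤ L e a (begin
          e + L     ≡⟨ +-comm e L ⟩
          L + e     ≡⟨ L+e≡a+b ⟩
          a + b     ≤⟨ +-monoʳ-≤ a (<⇒≤ b<L) ⟩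
          a + L     ∎)
        1≤e : 1 ≤ e
        1≤e = +-cancelˡ-≤ L 1 e (subst₂ _≤_ (+-comm 1 L) (sym L+e≡a+b) L<a+b)

    chainBound-superadditive : ∀ {a b} → 1 ≤ a → 1 ≤ b → L < a + b →
                               chainBound a + chainBound b ≤ chainBound (a + b)
    chainBound-superadditive {a} {b} 1≤a 1≤b L<a+b with L ≤? a | L ≤? b
    ... | yes L≤a | _       = chainBound-superadditive-long L≤a 1≤b
    ... | no _    | yes L≤b = subst₂ _≤_ (+-comm (chainBound b) (chainBound a)) (cong chainBound (+-comm b a))
                                (chainBound-superadditive-long L≤b 1≤a)
    ... | no L≰a  | no L≰b  = chainBound-superadditive-short (≰⇒> L≰a) (≰⇒> L≰b) L<a+b

    chainBound-remainder : ∀ {n} → L < n → chainBound n ≡ L C r + (n ∸ suc L + 1) * k + k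
    chainBound-remainder {n} L<n with m≤n⇒∃[o]m+o≡n L<n
    ... | e , refl = begin
      chainBound (suc L + e)               ≡⟨ cong chainBound (sym (+-suc L e)) ⟩
      chainBound (L + suc e)               ≡⟨ chainBound-L+ (suc e) ⟩
      L C r + k + suc e * k                ≡⟨ shift (L C r) k e ⟩
      L C r + (e + 1) * k + k              ≡⟨ cong (λ z → L C r + (z + 1) * k + k) (m+n∸m≡n (suc L) e) ⟨
      L C r + (suc L + e ∸ suc L + 1) * k + k ∎
      where
      open ≡-Reasoning
      shift : ∀ c k e → c + k + suc e * k ≡ c + (e + 1) * k + k
      shift = solve-∀

m+k≤n≡o+k⇒m≤o : ∀ {m n o k} → m + k ≤ n → n ≡ o + k → m ≤ o
m+k≤n≡o+k⇒m≤o {m} {o = o} {k} m+k≤n refl = +-cancelʳ-≤ k m o m+k≤n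

quotient-positive : ∀ {n p L q} → n ≡ p * L + q → q < L → L < n → 1 ≤ p
quotient-positive {p = zero}  n≡q q<L L<n = contradiction (≤-trans L<n (≤-reflexive n≡q)) (<-asym q<L)
quotient-positive {p = suc _} _   _   _   = s≤s z≤n

theorem3p2 : (n k l r t p q s : ℕ) → 2 ≤ k → 2 ≤ r → IsT k r t → t + 1 ≤ l → l ≤ n →
    n ≡ p * (l ∸ 1) + q → q < l ∸ 1 → IsS k r s →
    (H : Hypergraph n) → IsHypergraph H → Uniform r H → EdgeMaximal r k l H →
    ((s < l ∸ 1 → s < q → numEdges H ≤ p * ((l ∸ 1) C r) + p * k + q C r)
     × (s < l ∸ 1 → q ≤ s → numEdges H ≤ p * ((l ∸ 1) C r) + (p ∸ 1 + q) * k)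
     × (l ∸ 1 ≤ s → numEdges H ≤ (l ∸ 1) C r + (n ∸ l + 1) * k))
theorem3p2 n k zero    r         t p q s _ _          _   t+1≤0 _ _ _ _ _ _ _ _ =
  contradiction (≤-trans (m≤n+m 1 t) t+1≤0) λ ()
theorem3p2 n k (suc L) (suc r₁) t p q s _ (s≤s 1≤r₁) isT t+1≤l l≤n n≡ q<L isS H _ uniform (sparse , _) =
    (λ s<L s<q → m+k≤n≡o+k⇒m≤o (blocks s<L) (Blocks.blockBound-large-remainder L s<L {p = p} n≡ q<L s<q))
  , (λ s<L q≤s → m+k≤n≡o+k⇒m≤o (blocks s<L) (Blocks.blockBound-small-remainder L s<L {p = p} n≡ 1≤p q<L q≤s))
  , (λ L≤s → m+k≤n≡o+k⇒m≤o (chain L≤s) (Chain.chainBound-remainder L 1≤L L≤s l≤n))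
  where
  open Thresholds 1≤r₁ isT isS
  1≤L : 1 ≤ L
  1≤L = ≤-trans 1≤t (≤-pred (subst (_≤ suc L) (+-comm t 1) t+1≤l))
  1≤p : 1 ≤ p
  1≤p = quotient-positive n≡ q<L l≤n
  instance _ = >-nonZero 1≤L

  blocks : (s<L : s < L) → numEdges H + k ≤ Blocks.blockBound L s<L n
  blocks s<L = numEdges+k≤ blockBound uniform sparse (λ 1≤m m<l → C+k≤blockBound 1≤m (≤-pred m<l))
                 (λ _ _ _ → blockBound-superadditive _ _) (≤-trans (s≤s z≤n) l≤n)
    where open Blocks L s<L

  chain : (L≤s : L ≤ s) → numEdges H + k ≤ Chain.chainBound L 1≤L L≤s n
  chain L≤s = numEdges+k≤ chainBound uniform sparse (λ _ m<l → ≤-reflexive (sym (chainBound-≤ (≤-pred m<l))))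
                chainBound-superadditive (≤-trans (s≤s z≤n) l≤n)
    where open Chain L 1≤L L≤s
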